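{- Let $N$ be a homogeneous network with asymmetric inputs and $\tilde{N}$ its fundamental network. If $N$ is a lift of $\tilde{N}$, then $\tilde{N}$ is a subnetwork of $N$ (up to isomorphism).
   Context: A homogeneous network with asymmetric inputs has a finite cell set $C$, one cell type, $k$ edge types, each cell receiving exactly one edge of each type; it is represented by $\sigma_1,\dots,\sigma_k:C\to C$ (type-$i$ edge into $c$ comes from $\sigma_i(c)$). A network fibration between such networks is (determined by) a cell map $\varphi$ with $\varphi\circ\sigma_i=\sigma'_i\circ\varphi$ for all $i$. $N$ is a lift of $Q$ if $Q$ is a quotient network of $N$ (obtained from a balanced coloring), equivalently there is a surjective network fibration $N\to Q$. $S$ is a subnetwork of $M$ if its cells form a subset of $M$'s cells such that every edge of $M$ targeting a cell of $S$ belongs to $S$ and has source in $S$; up to isomorphism equivalent to an injective network fibration $S\to M$. The fundamental network $\tilde{N}$ has as cells the semigroup $\tilde{C}$ of maps $C\to C$ generated under composition by $Id_C,\sigma_1,\dots,\sigma_k$, represented by $\tilde{\sigma}_i(\gamma)=\sigma_i\circ\gamma$. -}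

module Defs where

open import Data.Nat using (ℕ)
open import Data.Fin using (Fin)
open import Data.Vec using (Vec; map; allFin)
open import Data.Product using (Σ; ∃; _×_; _,_)
open import Relation.Binary.PropositionalEquality using (_≡_)
open import Function.Definitions using (Injective; Surjective)

-- A homogeneous network with asymmetric inputs with k edge types:
-- a cell type together with σ i : Cell → Cell (the type-i input of c comes from σ i c).
record Network (k : ℕ) : Set₁ where
  field
    Cell : Set
    σ    : Fin k → Cell → Cell
open Network public

finNetwork : (k n : ℕ) → (Fin k → Fin n → Fin n) → Network k
finNetwork k n s = record { Cell = Fin n ; σ = s }

IsFibration : ∀ {k} (N M : Network k) → (Cell N → Cell M) → Set
IsFibration N M φ = ∀ i c → φ (σ N i c) ≡ σ M i (φ c)

IsLiftOf : ∀ {k} (N Q : Network k) → Set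
IsLiftOf N Q = Σ (Cell N → Cell Q) λ φ →
  IsFibration N Q φ × Surjective _≡_ _≡_ φ

IsSubnetworkOf : ∀ {k} (S M : Network k) → Set
IsSubnetworkOf S M = Σ (Cell S → Cell M) λ φ →
  IsFibration S M φ × Injective _≡_ _≡_ φ

-- Maps Fin n → Fin n are represented by their value tables Vec (Fin n) n
-- (so equality of maps is propositional equality of tables).
-- γ ↦ σ i ∘ γ is  map (σ i) γ ; the identity is allFin n.
module Fundamental {k n : ℕ} (s : Fin k → Fin n → Fin n) where

  data Generated : Vec (Fin n) n → Set where
    gen-id   : Generated (allFin n)
    gen-step : ∀ i {γ} → Generated γ → Generated (map (s i) γ)

  -- A cell of the fundamental network: an element of the generated semigroup
  -- (membership proof irrelevant, so cells are equal iff the maps are equal).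
  record FCell : Set where
    constructor fcell
    field
      fmap : Vec (Fin n) n
      .gen : Generated fmap
  open FCell public

  fσ : Fin k → FCell → FCell
  fσ i (fcell γ g) = fcell (map (s i) γ) (gen-step i g)

  fundamental : Network k
  fundamental = record { Cell = FCell ; σ = fσ }

fundamentalNetwork : ∀ {k n} → (Fin k → Fin n → Fin n) → Network k
fundamentalNetwork s = Fundamental.fundamental s

module Submission where

open import Defs
open import Data.Nat using (ℕ)
open import Data.Fin using (Fin)
open import Data.Fin.Properties using (_≟_)
open import Data.Vec using (map; allFin; lookup)
open import Data.Vec.Properties using (≡-dec; lookup-map; lookup-allFin)
open import Data.Product using (_,_)
open import Function using (_∘_)
open import Function.Definitions using (Injective; StrictlyInverseʳ)
open import Relation.Binary.PropositionalEquality
open import Relation.Nullary.Decidable using (recompute)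

-- Pick a cell c lying over the identity of the fundamental network. Evaluation
-- at c, γ ↦ γ c, is a fibration Ñ → N, and composing it with the lift gives a
-- fibration Ñ → Ñ fixing Id. Since Id generates Ñ under the σ̃ i, that composite
-- is the identity, so evaluation at c has a left inverse and is injective.

∘-isFibration : ∀ {k} {L M N : Network k} {f : Cell M → Cell N} {g : Cell L → Cell M} →
  IsFibration M N f → IsFibration L M g → IsFibration L N (f ∘ g)
∘-isFibration {f = f} f-fib g-fib i c = trans (cong f (g-fib i c)) (f-fib i _)

module _ {k n : ℕ} (s : Fin k → Fin n → Fin n) where
  open Fundamental s

  identityCell : FCell
  identityCell = fcell (allFin n) gen-id

  fmap-injective : ∀ {x y} → fmap x ≡ fmap y → x ≡ y
  fmap-injective {fcell _ _} {fcell _ _} refl = refl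

  evaluation : Fin n → FCell → Fin n
  evaluation c γ = lookup (fmap γ) c

  evaluation-isFibration : (c : Fin n) →
    IsFibration (fundamentalNetwork s) (finNetwork k n s) (evaluation c)
  evaluation-isFibration c i (fcell γ _) = lookup-map c (s i) γ

  evaluation-identityCell : (c : Fin n) → evaluation c identityCell ≡ c
  evaluation-identityCell = lookup-allFin

  module _ (f : FCell → FCell)
           (f-fib : IsFibration (fundamentalNetwork s) (fundamentalNetwork s) f)
           (f-id : f identityCell ≡ identityCell) where

    fmap-fixed : ∀ {γ} (g : Generated γ) → fmap (f (fcell γ g)) ≡ γ
    fmap-fixed gen-id                = cong fmap f-id
    fmap-fixed (gen-step i {γ} g) = begin
      fmap (f (fσ i (fcell γ g)))      ≡⟨ cong fmap (f-fib i (fcell γ g)) ⟩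
      map (s i) (fmap (f (fcell γ g))) ≡⟨ cong (map (s i)) (fmap-fixed g) ⟩
      map (s i) γ                      ∎
      where open ≡-Reasoning

    -- A cell's generation proof is irrelevant, so fmap-fixed is applied to a
    -- relevant copy and its result, an equation of decidable type, is recomputed.
    fibration-fixing-identityCell : ∀ x → f x ≡ x
    fibration-fixing-identityCell (fcell γ g) =
      fmap-injective (recompute (≡-dec _≟_ _ _) (fmap-fixed g))

  evaluation-injective : (φ : Fin n → FCell) →
    IsFibration (finNetwork k n s) (fundamentalNetwork s) φ →
    (c : Fin n) → φ c ≡ identityCell → Injective _≡_ _≡_ (evaluation c)
  evaluation-injective φ φ-fib c φc≡identityCell {x} {y} e = begin
    x                    ≡⟨ sym (φ∘evaluation≗id x) ⟩
    φ (evaluation c x)   ≡⟨ cong φ e ⟩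
    φ (evaluation c y)   ≡⟨ φ∘evaluation≗id y ⟩
    y                    ∎
    where
    open ≡-Reasoning
    φ∘evaluation≗id : StrictlyInverseʳ _≡_ (evaluation c) φ
    φ∘evaluation≗id = fibration-fixing-identityCell (φ ∘ evaluation c)
      (∘-isFibration {L = fundamentalNetwork s} {M = finNetwork k n s} {N = fundamentalNetwork s}
        {f = φ} {g = evaluation c} φ-fib (evaluation-isFibration c))
      (trans (cong φ (evaluation-identityCell c)) φc≡identityCell)

mainTheorem12 : (k n : ℕ) (s : Fin k → Fin n → Fin n) →
    IsLiftOf (finNetwork k n s) (fundamentalNetwork s) →
    IsSubnetworkOf (fundamentalNetwork s) (finNetwork k n s)
mainTheorem12 k n s (φ , φ-fib , φ-surj) =
  let (c , φc≡identityCell) = φ-surj (identityCell s)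
  in  evaluation s c , evaluation-isFibration s c ,
      evaluation-injective s φ φ-fib c (φc≡identityCell refl)
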